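{- Let $H=(T,U)$ be a modular graph with orbits $Q_1,\dots,Q_k$, let $H_i=(T_i,U_i)$ be the orbit graph of $Q_i$, and let $K=H_1\times\dots\times H_k$. Define $\phi:T\to V(K)$ by $\phi(v)=z$ where $v\in A_i(z_i)$ for $i=1,\dots,k$. Then $d^H(u,v)=d^K(\phi(u),\phi(v))$ for all $u,v\in T$.
   Context: Graphs are finite and connected; $d^G$ is the path metric. $H$ is modular if every three nodes have a median (a node $v$ with $d^H(a,v)+d^H(v,b)=d^H(a,b)$ for each pair $a,b$ of them). Two edges are mates if opposite in some 4-circuit; orbits are classes of the transitive closure of the mate relation. The orbit graph $H_i$ is obtained from $H$ by contracting all edges of $U-Q_i$ and identifying parallel edges; for $t\in T_i$, $A_i(t)\subseteq T$ is the node set of the connected component of $(T,U-Q_i)$ whose contraction creates the node $t$. The Cartesian product $H_1\times\dots\times H_k$ has node set $T_1\times\dots\times T_k$, two nodes being adjacent iff they differ in exactly one coordinate $i$ and those coordinates are adjacent in $H_i$; $z_i$ denotes the $i$th coordinate of $z$. -}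

module Defs where

open import Data.Nat using (ℕ; zero; suc; _+_; _≤_)
open import Data.Fin using (Fin)
open import Data.Bool using (Bool; T)
open import Data.Product using (Σ; ∃; ∃₂; _×_; _,_)
open import Relation.Binary.PropositionalEquality using (_≡_; _≢_)
open import Relation.Nullary using (¬_)
open import Relation.Binary.Construct.Closure.Equivalence using (EqClosure)

data Walk {A : Set} (Eq Adj : A → A → Set) : A → A → ℕ → Set where
  stop : ∀ {x y} → Eq x y → Walk Eq Adj x y zero
  step : ∀ {x y z m} → Adj x y → Walk Eq Adj y z m → Walk Eq Adj x z (suc m)

Dist : {A : Set} (Eq Adj : A → A → Set) → A → A → ℕ → Set
Dist Eq Adj x y m = Walk Eq Adj x y m × (∀ m' → Walk Eq Adj x y m' → m ≤ m')

module _ {n : ℕ} (adj : Fin n → Fin n → Bool) where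

  Adj : Fin n → Fin n → Set
  Adj a b = T (adj a b)

  IsSimpleGraph : Set
  IsSimpleGraph = (∀ a b → Adj a b → Adj b a) × (∀ a → ¬ Adj a a)

  Connected : Set
  Connected = ∀ u v → ∃ λ m → Walk _≡_ Adj u v m

  dH : Fin n → Fin n → ℕ → Set
  dH = Dist _≡_ Adj

  Between : Fin n → Fin n → Fin n → Set
  Between x v y = ∃₂ λ p q → dH x v p × dH v y q × dH x y (p + q)

  IsMedian : Fin n → Fin n → Fin n → Fin n → Set
  IsMedian a b c v = Between a v b × Between a v c × Between b v c

  Modular : Set
  Modular = IsSimpleGraph × Connected
          × (∀ a b c → ∃ λ v → IsMedian a b c v)

  -- oriented edges (each undirected edge ab appears as (a,b) and (b,a))
  Edge : Set
  Edge = Σ (Fin n) λ a → Σ (Fin n) λ b → Adj a b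

  Distinct4 : Fin n → Fin n → Fin n → Fin n → Set
  Distinct4 a b c d = a ≢ b × a ≢ c × a ≢ d × b ≢ c × b ≢ d × c ≢ d

  -- generating steps of the orbit relation:
  --  * `rev`  : (a,b) and (b,a) are the same undirected edge;
  --  * `mate` : ab and cd are opposite in the 4-circuit a-b-d-c-a.
  data EdgeStep : Edge → Edge → Set where
    rev  : ∀ {a b} (e : Adj a b) (e' : Adj b a) →
           EdgeStep (a , b , e) (b , a , e')
    mate : ∀ {a b c d} (e : Adj a b) (e' : Adj c d) →
           Distinct4 a b c d → Adj b d → Adj c a →
           EdgeStep (a , b , e) (c , d , e')

  SameOrbit : Edge → Edge → Set
  SameOrbit = EqClosure EdgeStep

  module _ {k : ℕ} (orb : (a b : Fin n) → Adj a b → Fin k) where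

    orbE : Edge → Fin k
    orbE (a , b , e) = orb a b e

    IsOrbitLabelling : Set
    IsOrbitLabelling =
        (∀ e f → orbE e ≡ orbE f → SameOrbit e f)
      × (∀ e f → SameOrbit e f → orbE e ≡ orbE f)
      × (∀ i → ∃ λ e → orbE e ≡ i)

    OffAdj : Fin k → Fin n → Fin n → Set
    OffAdj i a b = Σ (Adj a b) λ e → orb a b e ≢ i

    -- u and v lie in the same component of (T, U - Q_i); the nodes of
    -- the orbit graph H_i are these components, i.e. the sets A_i(t).
    SameComp : Fin k → Fin n → Fin n → Set
    SameComp i = EqClosure (OffAdj i)

    -- adjacency in the orbit graph H_i between the nodes A_i-containing
    -- x and y: distinct nodes joined by an edge of Q_i (parallel edges
    -- identified).
    OrbitAdj : Fin k → Fin n → Fin n → Set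
    OrbitAdj i x y =
        ¬ SameComp i x y
      × ∃₂ λ a b → Σ (Adj a b) λ e →
          orb a b e ≡ i × SameComp i x a × SameComp i b y

    -- nodes of K = H_1 × … × H_k, represented by a choice of
    -- representative z i ∈ T of the i-th coordinate (a node of H_i)
    KNode : Set
    KNode = Fin k → Fin n

    KEq : KNode → KNode → Set
    KEq z z' = ∀ i → SameComp i (z i) (z' i)

    KAdj : KNode → KNode → Set
    KAdj z z' = ∃ λ i →
        (∀ j → j ≢ i → SameComp j (z j) (z' j))
      × OrbitAdj i (z i) (z' i)

    dK : KNode → KNode → ℕ → Set
    dK = Dist KEq KAdj

    -- φ(v) = z with v ∈ A_i(z_i) for all i: the i-th coordinate is the
    -- component of (T, U - Q_i) containing v, represented by v itself.
    φ : Fin n → KNode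
    φ v = λ _ → v

-- For an orbit label i, count the edges with label i along a walk. In a modular graph
-- all geodesics from x to t carry the same number of i-edges, since any two of them
-- can be related across 4-circuits (quadrangle condition) whose opposite edges are
-- mates; moreover no walk from x to t carries fewer. A walk in H maps to a walk in K of
-- the same length, and a walk in K projects in coordinate i to a walk in H whose
-- i-edges come only from the steps of K in coordinate i. Hence every K-walk from φ u
-- to φ v has, for each i, at least as many i-steps as a geodesic from u to v has
-- i-edges, and summing over i gives d^K(φ u, φ v) = d^H(u, v).
module Submission where

open import Defs
open import Data.Bool using (Bool; if_then_else_)
open import Data.Bool.Properties using (T-irrelevant)
open import Data.Empty using (⊥; ⊥-elim)
open import Data.Fin using (Fin; zero; suc)
open import Data.Fin.Properties using (any?; _≟_)
open import Data.Nat using (ℕ; zero; suc; _+_; _≤_; _<_; z≤n; s≤s)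
open import Data.Nat.Induction using (<-rec)
open import Data.Nat.Properties hiding (_≟_)
open import Algebra.Properties.CommutativeMonoid.Sum +-0-commutativeMonoid
  using (sum; sum-replicate-zero; ∑-distrib-+)
open import Data.Product using (_×_; Σ; ∃; _,_; proj₁; proj₂)
open import Data.Sum using (_⊎_; inj₁; inj₂)
open import Function using (_∘_)
open import Relation.Binary.Construct.Closure.ReflexiveTransitive using (ε; _◅_; _◅◅_)
open import Relation.Binary.Construct.Closure.Symmetric using (fwd; bwd)
open import Relation.Binary.Definitions using (tri<; tri≈; tri>)
open import Relation.Binary.PropositionalEquality
open import Relation.Nullary using (¬_; Dec; yes; no; does; contradiction)
open import Relation.Nullary.Decidable using (dec-true; dec-false; map′; _×-dec_; T?)

δ : ∀ {k} → Fin k → Fin k → ℕ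
δ j i = if does (j ≟ i) then 1 else 0

δ-diag : ∀ {k} (i : Fin k) → δ i i ≡ 1
δ-diag i rewrite dec-true (i ≟ i) refl = refl

δ-≢ : ∀ {k} {j i : Fin k} → j ≢ i → δ j i ≡ 0
δ-≢ {j = j} {i} j≢i rewrite dec-false (j ≟ i) j≢i = refl

∑-δ : ∀ {k} (j : Fin k) → sum (δ j) ≡ 1
∑-δ {suc k} zero    = cong suc (sum-replicate-zero k)
∑-δ {suc k} (suc j) = ∑-δ j

sum-mono-≤ : ∀ {k} {f g : Fin k → ℕ} → (∀ i → f i ≤ g i) → sum f ≤ sum g
sum-mono-≤ {zero}  f≤g = z≤n
sum-mono-≤ {suc k} f≤g = +-mono-≤ (f≤g zero) (sum-mono-≤ (λ i → f≤g (suc i)))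

NoShorterWalk : {A : Set} (Eq R : A → A → Set) → A → A → ℕ → Set
NoShorterWalk Eq R x y m = ∀ m′ → Walk Eq R x y m′ → m ≤ m′

module _ {A : Set} {Eq R : A → A → Set} where

  noShorterWalk-tail : ∀ {x a y m} → R x a → NoShorterWalk Eq R x y (suc m) → NoShorterWalk Eq R a y m
  noShorterWalk-tail e min m′ w = ≤-pred (min (suc m′) (step e w))

  dist-functional : ∀ {x y m m′} → Dist Eq R x y m → Dist Eq R x y m′ → m ≡ m′
  dist-functional (w , min) (w′ , min′) = ≤-antisym (min _ w′) (min′ _ w)

  shortest-walk : (∀ j x y → Dec (Walk Eq R x y j)) →
                  ∀ {x y m} → Walk Eq R x y m → ∃ (Dist Eq R x y)
  shortest-walk walk? {x} {y} {m} = <-rec (λ m → Walk Eq R x y m → ∃ (Dist Eq R x y)) shorten m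
    where
    shorten : ∀ m → (∀ {j} → j < m → Walk Eq R x y j → ∃ (Dist Eq R x y)) →
              Walk Eq R x y m → ∃ (Dist Eq R x y)
    shorten m shorten-below w with anyUpTo? (λ j → walk? j x y) m
    ... | yes (j , j<m , w′) = shorten-below j<m w′
    ... | no ¬shorter = m , w , λ m′ w′ → ≮⇒≥ (λ m′<m → ¬shorter (m′ , m′<m , w′))

  module _ {k} (label : ∀ {x y} → R x y → Fin k) where

    count : ∀ {x y m} → Fin k → Walk Eq R x y m → ℕ
    count i (stop _)   = 0
    count i (step e w) = δ (label e) i + count i w

    ∑-count : ∀ {x y m} (w : Walk Eq R x y m) → sum (λ i → count i w) ≡ m
    ∑-count (stop _)   = sum-replicate-zero k
    ∑-count (step e w) = begin
      sum (λ i → δ (label e) i + count i w)          ≡⟨ ∑-distrib-+ (δ (label e)) (λ i → count i w) ⟩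
      sum (δ (label e)) + sum (λ i → count i w)      ≡⟨ cong₂ _+_ (∑-δ (label e)) (∑-count w) ⟩
      suc _                                          ∎
      where open ≡-Reasoning

module _ {A : Set} {R : A → A → Set} where

  _++ʷ_ : ∀ {x y z m m′} → Walk _≡_ R x y m → Walk _≡_ R y z m′ → Walk _≡_ R x z (m + m′)
  stop refl ++ʷ w′ = w′
  step e w  ++ʷ w′ = step e (w ++ʷ w′)

  count-++ : ∀ {k} (label : ∀ {x y} → R x y → Fin k) i {x y z m m′}
             (w : Walk _≡_ R x y m) (w′ : Walk _≡_ R y z m′) →
             count label i (w ++ʷ w′) ≡ count label i w + count label i w′
  count-++ label i (stop refl) w′ = refl
  count-++ label i (step e w)  w′ =
    trans (cong (δ (label e) i +_) (count-++ label i w w′)) (sym (+-assoc (δ (label e) i) _ _))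

  module _ (R-sym : ∀ {x y} → R x y → R y x) where

    reverse : ∀ {x y m} → Walk _≡_ R x y m → Walk _≡_ R y x m
    reverse (stop refl) = stop refl
    reverse {m = suc m} (step e w) =
      subst (Walk _≡_ R _ _) (+-comm m 1) (reverse w ++ʷ step (R-sym e) (stop refl))

    dist-sym : ∀ {x y m} → Dist _≡_ R x y m → Dist _≡_ R y x m
    dist-sym (w , min) = reverse w , λ m′ w′ → min m′ (reverse w′)

walk? : ∀ {n} {R : Fin n → Fin n → Set} → (∀ x y → Dec (R x y)) →
        ∀ j x y → Dec (Walk _≡_ R x y j)
walk? R? zero    x y = map′ stop (λ { (stop x≡y) → x≡y }) (x ≟ y)
walk? R? (suc j) x y = map′ (λ { (z , e , w) → step e w }) (λ { (step e w) → _ , e , w })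
                            (any? (λ z → R? x z ×-dec walk? R? j z y))

half-two : ∀ {p} → p + p ≡ 2 → p ≡ 1
half-two {suc zero}    refl = refl
half-two {suc (suc p)} eq   = ⊥-elim (m+1+n≢0 p (suc-injective (suc-injective eq)))

module SimpleGraph {n} (adj : Fin n → Fin n → Bool) (simple : IsSimpleGraph adj) where

  Walkᴴ : Fin n → Fin n → ℕ → Set
  Walkᴴ = Walk _≡_ (Adj adj)

  adj-sym : ∀ {x y} → Adj adj x y → Adj adj y x
  adj-sym = proj₁ simple _ _

  adj⇒≢ : ∀ {x y} → Adj adj x y → x ≢ y
  adj⇒≢ {x} e refl = proj₂ simple x e

  dist-zero⇒≡ : ∀ {x y} → dH adj x y 0 → x ≡ y
  dist-zero⇒≡ (stop x≡y , _) = x≡y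

  dist-one⇒adj : ∀ {x y} → dH adj x y 1 → Adj adj x y
  dist-one⇒adj (step e (stop refl) , _) = e

  adj⇒dist-one : ∀ {x y} → Adj adj x y → dH adj x y 1
  adj⇒dist-one e = step e (stop refl) , λ
    { zero    (stop x≡y) → ⊥-elim (adj⇒≢ e x≡y)
    ; (suc _) _          → s≤s z≤n
    }

  between-edge : ∀ {x v y} → Adj adj x y → Between adj x v y → v ≡ x ⊎ v ≡ y
  between-edge e (zero  , _     , xv , _  , _)  = inj₁ (sym (dist-zero⇒≡ xv))
  between-edge e (suc p , zero  , _  , vy , _)  = inj₂ (dist-zero⇒≡ vy)
  between-edge e (suc p , suc q , _  , _  , xy) =
    ⊥-elim (m+1+n≢0 p (suc-injective (dist-functional xy (adj⇒dist-one e))))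

  geodesic : ∀ {x y m} → Walkᴴ x y m → ∃ (dH adj x y)
  geodesic = shortest-walk (walk? (λ a b → T? (adj a b)))

  neighbour-not-between-equidistant : ∀ {a b t p} → Adj adj a b → Between adj a b t →
                                      dH adj a t p → dH adj b t p → ⊥
  neighbour-not-between-equidistant e (p₁ , q₁ , ab , bt , at) da db
    with refl ← dist-functional ab (adj⇒dist-one e) | refl ← dist-functional bt db =
    1+n≢n (dist-functional at da)

module ModularGraph {n} (adj : Fin n → Fin n → Bool) (modular : Modular adj) where

  open SimpleGraph adj (proj₁ modular) public

  connected : Connected adj
  connected = proj₁ (proj₂ modular)

  median : ∀ a b c → ∃ (IsMedian adj a b c)
  median = proj₂ (proj₂ modular)

  equidistant-nonadjacent : ∀ {x y t p} → Adj adj x y → dH adj x t p → dH adj y t p → ⊥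
  equidistant-nonadjacent {x} {y} {t} e dx dy with median x y t
  ... | v , xvy , xvt , yvt with between-edge e xvy
  ...   | inj₁ refl = neighbour-not-between-equidistant (adj-sym e) yvt dy dx
  ...   | inj₂ refl = neighbour-not-between-equidistant e xvt dx dy

  common-neighbours-dist-two : ∀ {x a b t j} → a ≢ b → Adj adj x a → Adj adj x b →
                               dH adj a t j → dH adj b t j → dH adj a b 2
  common-neighbours-dist-two a≢b xa xb da db = step (adj-sym xa) (step xb (stop refl)) , longer
    where
    longer : ∀ m → Walkᴴ _ _ m → 2 ≤ m
    longer zero          (stop a≡b)         = ⊥-elim (a≢b a≡b)
    longer (suc zero)    (step e (stop refl)) = ⊥-elim (equidistant-nonadjacent e da db)
    longer (suc (suc m)) _                  = s≤s (s≤s z≤n)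

  quadrangle : ∀ {x a b t j} → a ≢ b → Adj adj x a → Adj adj x b →
               dH adj a t (suc j) → dH adj b t (suc j) →
               ∃ λ m → Adj adj a m × Adj adj b m × dH adj m t j
  quadrangle {a = a} {b} {t} a≢b xa xb da db with median a b t
  ... | v , (p , q , av , vb , ab) , (p′ , r , av′ , vt , at) , (q′ , r′ , bv , vt′ , bt)
    with refl ← dist-functional av′ av | refl ← dist-functional bv (dist-sym adj-sym vb)
       | refl ← dist-functional vt′ vt
    with refl ← +-cancelʳ-≡ r p q (trans (dist-functional at da) (sym (dist-functional bt db)))
    with refl ← half-two {p} (dist-functional ab (common-neighbours-dist-two a≢b xa xb da db))
    with refl ← suc-injective (dist-functional at da)
    = v , dist-one⇒adj av , dist-one⇒adj bv , vt

  neighbour-distance : ∀ {x y t m d} → Adj adj x y → dH adj x t m → dH adj y t d →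
                       suc d ≡ m ⊎ d ≡ suc m
  neighbour-distance {m = m} {d} e (P , minP) (Q , minQ) with <-cmp d m
  ... | tri< d<m _ _ = inj₁ (≤-antisym d<m (minP _ (step e Q)))
  ... | tri≈ _ refl _ = ⊥-elim (equidistant-nonadjacent e (P , minP) (Q , minQ))
  ... | tri> _ _ m<d = inj₂ (≤-antisym (minQ _ (step (adj-sym e) P)) m<d)

  module Labelling {k} (orb : (a b : Fin n) → Adj adj a b → Fin k)
                   (orbit-invariant : ∀ e f → SameOrbit adj e f → orbE adj orb e ≡ orbE adj orb f)
                   where

    orbit : ∀ {a b} → Adj adj a b → Fin k
    orbit {a} {b} = orb a b

    countᴴ : ∀ {x y m} → Fin k → Walkᴴ x y m → ℕ
    countᴴ = count orbit

    orbit-reverse : ∀ {a b} (e : Adj adj a b) (e′ : Adj adj b a) → orb a b e ≡ orb b a e′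
    orbit-reverse e e′ = orbit-invariant _ _ (fwd (rev e e′) ◅ ε)

    square-opposite-orbit : ∀ {x a b c} (xa : Adj adj x a) (ac : Adj adj a c)
                            (bc : Adj adj b c) (bx : Adj adj b x) → x ≢ c → a ≢ b →
                            orb x a xa ≡ orb b c bc
    square-opposite-orbit xa ac bc bx x≢c a≢b = orbit-invariant _ _ (fwd mates ◅ ε)
      where
      mates = mate xa bc (adj⇒≢ xa , ≢-sym (adj⇒≢ bx) , x≢c , a≢b , adj⇒≢ ac , adj⇒≢ bc) ac bx

    count-around-square : ∀ i {x a b c} (xa : Adj adj x a) (ac : Adj adj a c)
                          (xb : Adj adj x b) (bc : Adj adj b c) → x ≢ c → a ≢ b →
                          δ (orb x a xa) i + δ (orb a c ac) i ≡ δ (orb x b xb) i + δ (orb b c bc) i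
    count-around-square i {x} {a} {b} {c} xa ac xb bc x≢c a≢b = begin
      δ (orb x a xa) i + δ (orb a c ac) i  ≡⟨ cong₂ (λ j j′ → δ j i + δ j′ i) xa~bc ac~xb ⟩
      δ (orb b c bc) i + δ (orb x b xb) i  ≡⟨ +-comm (δ (orb b c bc) i) _ ⟩
      δ (orb x b xb) i + δ (orb b c bc) i  ∎
      where
      open ≡-Reasoning
      xa~bc = square-opposite-orbit xa ac bc (adj-sym xb) x≢c a≢b
      ac~xb = square-opposite-orbit ac (adj-sym bc) xb xa a≢b (≢-sym x≢c)

    -- If the geodesics leave x through distinct neighbours a and b, the quadrangle
    -- condition gives a common neighbour c of a and b one step closer to t, and
    -- x a c b is a 4-circuit whose opposite edges are mates.
    geodesic-count-step :
      ∀ i m {x t a b} → NoShorterWalk _≡_ (Adj adj) x t (suc (suc m)) →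
      (∀ {y} → NoShorterWalk _≡_ (Adj adj) y t (suc m) →
               (P P′ : Walkᴴ y t (suc m)) → countᴴ i P ≡ countᴴ i P′) →
      (e : Adj adj x a) (r : Walkᴴ a t (suc m)) (e′ : Adj adj x b) (r′ : Walkᴴ b t (suc m)) →
      countᴴ i (step e r) ≡ countᴴ i (step e′ r′)
    geodesic-count-step i m {x} {a = a} {b} min ih e r e′ r′ with a ≟ b
    ... | yes refl = cong₂ (λ e r → δ (orb x a e) i + r) (T-irrelevant e e′)
                                (ih (noShorterWalk-tail {a = a} e min) r r′)
    ... | no a≢b with quadrangle a≢b e e′ (r , noShorterWalk-tail {a = a} e min)
                                           (r′ , noShorterWalk-tail {a = b} e′ min)
    ...   | c , ac , bc , (R , _) = begin
      δ (orb x a e) i + countᴴ i r                       ≡⟨ cong (δ (orb x a e) i +_) (ih min-a r (step ac R)) ⟩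
      δ (orb x a e) i + (δ (orb a c ac) i + countᴴ i R)  ≡⟨ sym (+-assoc (δ (orb x a e) i) _ _) ⟩
      (δ (orb x a e) i + δ (orb a c ac) i) + countᴴ i R  ≡⟨ cong (_+ countᴴ i R) (count-around-square i e ac e′ bc x≢c a≢b) ⟩
      (δ (orb x b e′) i + δ (orb b c bc) i) + countᴴ i R ≡⟨ +-assoc (δ (orb x b e′) i) _ _ ⟩
      δ (orb x b e′) i + (δ (orb b c bc) i + countᴴ i R) ≡⟨ cong (δ (orb x b e′) i +_) (ih min-b (step bc R) r′) ⟩
      δ (orb x b e′) i + countᴴ i r′                     ∎
      where
      open ≡-Reasoning
      min-a = noShorterWalk-tail {a = a} e min
      min-b = noShorterWalk-tail {a = b} e′ min
      x≢c : x ≢ c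
      x≢c refl = 1+n≰n (≤-trans (n≤1+n _) (min m R))

    geodesic-count-unique : ∀ i m {x t} → NoShorterWalk _≡_ (Adj adj) x t m →
                            (P P′ : Walkᴴ x t m) → countᴴ i P ≡ countᴴ i P′
    geodesic-count-unique i zero _ (stop _) (stop _) = refl
    geodesic-count-unique i (suc zero) _ (step {x} {t} e (stop refl)) (step e′ (stop refl)) =
      cong (λ e → δ (orb x t e) i + 0) (T-irrelevant e e′)
    geodesic-count-unique i (suc (suc m)) min (step e r) (step e′ r′) =
      geodesic-count-step i m min (geodesic-count-unique i (suc m)) e r e′ r′

    -- Induction on w: its first step x → y moves one step towards or away from t,
    -- and accordingly either x → y followed by a geodesic from y, or y → x followed
    -- by P, is a geodesic.
    geodesic-count-minimal : ∀ i {x t m m′} → NoShorterWalk _≡_ (Adj adj) x t m →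
                             (P : Walkᴴ x t m) (w : Walkᴴ x t m′) → countᴴ i P ≤ countᴴ i w
    geodesic-count-minimal i min (stop _)   _          = z≤n
    geodesic-count-minimal i min (step e P) (stop x≡t) with () ← min 0 (stop x≡t)
    geodesic-count-minimal i {x} min (step e P) (step {y = y} f w′) with geodesic w′
    ... | d , Q , minQ with neighbour-distance f (step e P , min) (Q , minQ)
    ...   | inj₁ refl = begin
      countᴴ i (step e P)               ≡⟨ geodesic-count-unique i _ min (step e P) (step f Q) ⟩
      δ (orb x y f) i + countᴴ i Q      ≤⟨ +-monoʳ-≤ (δ (orb x y f) i) (geodesic-count-minimal i minQ Q w′) ⟩
      δ (orb x y f) i + countᴴ i w′     ∎
      where open ≤-Reasoning
    ...   | inj₂ refl = begin
      countᴴ i (step e P)                         ≤⟨ m≤n+m _ (δ (orb y x (adj-sym f)) i) ⟩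
      countᴴ i (step (adj-sym f) (step e P))      ≡⟨ geodesic-count-unique i _ minQ (step (adj-sym f) (step e P)) Q ⟩
      countᴴ i Q                                  ≤⟨ geodesic-count-minimal i minQ Q w′ ⟩
      countᴴ i w′                                 ≤⟨ m≤n+m _ (δ (orb x y f) i) ⟩
      δ (orb x y f) i + countᴴ i w′               ∎
      where open ≤-Reasoning

    component-walk : ∀ i {x y} → SameComp adj orb i x y →
                     ∃ λ m → Σ (Walkᴴ x y m) λ w → countᴴ i w ≡ 0
    component-walk i ε = 0 , stop refl , refl
    component-walk i (fwd (e , ≢i) ◅ rest) with component-walk i rest
    ... | m , w , none = suc m , step e w , cong₂ _+_ (δ-≢ ≢i) none
    component-walk i (bwd (e , ≢i) ◅ rest) with component-walk i rest
    ... | m , w , none = suc m , step (adj-sym e) w ,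
                         cong₂ _+_ (δ-≢ (≢i ∘ trans (orbit-reverse e (adj-sym e)))) none

    orbit-edge-separates : ∀ {x y} (e : Adj adj x y) → ¬ SameComp adj orb (orb x y e) x y
    orbit-edge-separates {x} {y} e x~y with component-walk (orb x y e) x~y
    ... | _ , w , none = contradiction (subst₂ _≤_ one-edge none edge≤w) λ ()
      where
      edge≤w = geodesic-count-minimal (orb x y e) (proj₂ (adj⇒dist-one e)) (step e (stop refl)) w
      one-edge = trans (+-identityʳ _) (δ-diag (orb x y e))

    KWalk : KNode adj orb → KNode adj orb → ℕ → Set
    KWalk = Walk (KEq adj orb) (KAdj adj orb)

    countᴷ : ∀ {z z′ m} → Fin k → KWalk z z′ m → ℕ
    countᴷ = count proj₁

    φ-walk : ∀ {x y m} → Walkᴴ x y m → KWalk (φ adj orb x) (φ adj orb y) m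
    φ-walk (stop refl) = stop (λ _ → ε)
    φ-walk (step {x} {y} e w) = step (orb x y e , off-orbit , orbit-adj) (φ-walk w)
      where
      off-orbit = λ j j≢ → fwd (e , ≢-sym j≢) ◅ ε
      orbit-adj = orbit-edge-separates e , x , y , e , refl , ε , ε

    project : ∀ i {z z′ m} (w : KWalk z z′ m) {x y} →
              SameComp adj orb i x (z i) → SameComp adj orb i (z′ i) y →
              ∃ λ m′ → Σ (Walkᴴ x y m′) λ w′ → countᴴ i w′ ≤ countᴷ i w
    project i (stop z≈z′) x~z z′~y with component-walk i (x~z ◅◅ z≈z′ i ◅◅ z′~y)
    ... | _ , w′ , none = _ , w′ , ≤-reflexive none
    project i (step (j , others , _) w) x~z z′~y with j ≟ i
    project i (step (j , _ , (_ , a , b , e , e∈Qᵢ , z~a , b~z′)) w) x~z z′~y | yes refl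
      with component-walk i (x~z ◅◅ z~a) | project i w b~z′ z′~y
    ... | _ , w₁ , none | _ , w₂ , w₂≤w = _ , w₁ ++ʷ step e w₂ , (begin
      countᴴ i (w₁ ++ʷ step e w₂)                   ≡⟨ count-++ orbit i w₁ (step e w₂) ⟩
      countᴴ i w₁ + (δ (orb a b e) i + countᴴ i w₂) ≡⟨ cong₂ (λ c d → c + (d + countᴴ i w₂)) none e-counts ⟩
      suc (countᴴ i w₂)                             ≤⟨ s≤s w₂≤w ⟩
      suc (countᴷ i w)                              ∎)
      where
      open ≤-Reasoning
      e-counts = trans (cong (λ j → δ j i) e∈Qᵢ) (δ-diag i)
    project i (step (j , others , _) w) x~z z′~y | no j≢i
      with project i w (x~z ◅◅ others i (≢-sym j≢i)) z′~y
    ... | _ , w′ , w′≤w = _ , w′ , w′≤w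

    φ-preserves-dist : ∀ {u v m} → dH adj u v m → dK adj orb (φ adj orb u) (φ adj orb v) m
    φ-preserves-dist (P , min) = φ-walk P , λ m′ w →
      subst₂ _≤_ (∑-count orbit P) (∑-count proj₁ w) (sum-mono-≤ (count-bound w))
      where
      count-bound : ∀ {m′} (w : KWalk _ _ m′) i → countᴴ i P ≤ countᴷ i w
      count-bound w i with project i w ε ε
      ... | _ , w′ , w′≤w = ≤-trans (geodesic-count-minimal i min P w′) w′≤w

    φ-reflects-dist : ∀ {u v m} → dK adj orb (φ adj orb u) (φ adj orb v) m → dH adj u v m
    φ-reflects-dist {u} {v} dK-uv with geodesic (proj₂ (connected u v))
    ... | _ , dH-uv = subst (dH adj u v) (dist-functional (φ-preserves-dist dH-uv) dK-uv) dH-uv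

mainTheorem7 : ∀ {n : ℕ} (adj : Fin n → Fin n → Bool) → Modular adj →
               ∀ {k : ℕ} (orb : (a b : Fin n) → Adj adj a b → Fin k) →
               IsOrbitLabelling adj orb →
               ∀ (u v : Fin n) (m : ℕ) →
               (dH adj u v m → dK adj orb (φ adj orb u) (φ adj orb v) m)
               × (dK adj orb (φ adj orb u) (φ adj orb v) m → dH adj u v m)
mainTheorem7 adj modular orb labelling u v m = φ-preserves-dist , φ-reflects-dist
  where open ModularGraph adj modular
        open Labelling orb (proj₁ (proj₂ labelling))
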